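{- Let $k\ge2$, let $L$ be any input to bin packing with cardinality constraint $k$, and let $1\le j\le k-1$. In the final packing produced by First Fit on $L$, every bin containing exactly $j$ items, except for at most one such bin, has level above $\frac{j}{j+1}$. Moreover, every bin whose number of items lies in $[j,k-1]$, except for at most one such bin, has level above $\frac{j}{j+1}$.
   Context: Bin packing with cardinality constraints (BPCC): there is a global integer parameter $k\ge 2$; the input is a sequence of items with sizes $s_i\in(0,1]$. Items must be partitioned into bins so that each bin has total size (level) at most $1$ and contains at most $k$ items. First Fit (FF) packs each arriving item $i$ into the minimum-index (earliest opened) bin that currently has at most $k-1$ items and level at most $1-s_i$, opening a new bin if none exists.
   Formalization: The item sizes $s_i$ are rational numbers in (0,1] rather than arbitrary real ones. -}

module Defs where

open import Data.Nat as ℕ using (ℕ; suc)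
import Data.Nat.Properties as ℕP
open import Data.Integer using (+_)
open import Data.Rational using (ℚ; _/_; _+_; _≤_; _<_; 0ℚ; 1ℚ)
open import Data.Rational.Properties using (_≤?_)
open import Data.List using (List; []; _∷_; _++_; [_]; length; foldr; foldl; filter)
open import Data.List.Relation.Unary.All using (All)
open import Data.Product using (_×_)
open import Relation.Nullary using (yes; no)
open import Relation.Nullary.Decidable using (_×-dec_)

-- A bin is the list of sizes of the items it contains (in arrival order).
Bin : Set
Bin = List ℚ

-- A packing is the list of bins, in the order in which they were opened.
Packing : Set
Packing = List Bin

level : Bin → ℚ
level = foldr _+_ 0ℚ

card : Bin → ℕ
card = length

ValidInput : List ℚ → Set
ValidInput = All (λ s → (0ℚ < s) × (s ≤ 1ℚ))

ffInsert : ℕ → ℚ → Packing → Packing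
ffInsert k s [] = [ [ s ] ]
ffInsert k s (b ∷ bs) with (suc (card b) ℕ.≤? k) ×-dec ((level b + s) ≤? 1ℚ)
... | yes _ = (b ++ [ s ]) ∷ bs
... | no  _ = b ∷ ffInsert k s bs

firstFit : ℕ → List ℚ → Packing
firstFit k = foldl (λ P s → ffInsert k s P) []

thr : ℕ → ℚ
thr j = (+ j) / suc j

module Submission where

-- Let bin A be opened before bin B.  When First Fit placed an item x of B, the
-- bin A already existed and was skipped, and bins only grow; so at the end A is
-- either full (k items) or too high for x (level A + x > 1).
--
-- Call a bin j-light if it has between j and k-1 items and level ≤ j/(j+1).
-- If A is j-light, the invariant makes every item of B exceed 1 - level A;
-- summing over the n ≥ j items of B gives  n < n·level A + level B, and since
-- (n+1)·j/(j+1) ≤ n this forces level B > j/(j+1).  So no two bins are j-light,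
-- and a list in which no two entries share a property has at most one such entry.

open import Defs
open import Data.Nat using (ℕ; _≤_; _∸_)
open import Data.Nat.Properties using (_≟_)
open import Data.Nat as ℕ using ()
open import Data.Rational using (ℚ)
open import Data.Rational.Properties using ()
open import Data.Rational as ℚ using ()
open import Data.List using (List; length; filter)
open import Data.Product using (_×_)
open import Relation.Nullary.Decidable using (_×-dec_)

open import Algebra.Bundles using (CommutativeMonoid)
open import Data.Nat using (zero; suc; _<_; z≤n; s≤s)
import Data.Nat.Properties as ℕP
open import Data.Integer as ℤ using (+_)
import Data.Integer.Properties as ℤP
open import Data.Integer.Tactic.RingSolver using (solve-∀)
open import Data.Rational using (_+_; 0ℚ; 1ℚ; toℚᵘ)
import Data.Rational.Properties as ℚP
open import Data.Rational.Unnormalised as ℚᵘ using (mkℚᵘ; *≡*; *≤*)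
import Data.Rational.Unnormalised.Properties as ℚᵘP
open import Data.List using ([]; _∷_; _++_; [_]; foldr; foldl)
import Data.List.Properties as ListP
open import Data.List.Relation.Unary.All as All using (All; []; _∷_)
import Data.List.Relation.Unary.All.Properties as AllP
open import Data.List.Relation.Unary.AllPairs as AllPairs using (AllPairs; []; _∷_)
open import Data.Product using (_,_)
open import Data.Sum using (_⊎_; inj₁; inj₂)
open import Data.Empty using (⊥-elim)
open import Relation.Nullary using (¬_; yes; no)
open import Relation.Unary using (Decidable)
open import Relation.Binary.PropositionalEquality using (_≡_; refl; sym; trans; cong; subst; subst₂)

open import Algebra.Properties.Monoid.Mult ℚP.+-0-monoid using ()
  renaming (_×_ to _·_)
open import Algebra.Properties.Monoid.Mult ℚᵘP.+-0-monoid using ()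
  renaming (_×_ to _·ᵘ_; ×-congʳ to ·ᵘ-congʳ)
open import Algebra.Properties.CommutativeSemigroup
  (CommutativeMonoid.commutativeSemigroup ℚP.+-0-commutativeMonoid)
  using (interchange)

·-mono-≤ : ∀ n {p q} → p ℚ.≤ q → n · p ℚ.≤ n · q
·-mono-≤ zero    p≤q = ℚP.≤-refl
·-mono-≤ (suc n) p≤q = ℚP.+-mono-≤ p≤q (·-mono-≤ n p≤q)

toℚᵘ-homo-· : ∀ n p → toℚᵘ (n · p) ℚᵘ.≃ n ·ᵘ toℚᵘ p
toℚᵘ-homo-· zero    p = ℚᵘP.≃-refl
toℚᵘ-homo-· (suc n) p =
  ℚᵘP.≃-trans (ℚP.toℚᵘ-homo-+ p (n · p)) (ℚᵘP.+-congʳ (toℚᵘ p) (toℚᵘ-homo-· n p))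

·ᵘ-mkℚᵘ : ∀ n i d → n ·ᵘ mkℚᵘ i d ℚᵘ.≃ mkℚᵘ (+ n ℤ.* i) d
·ᵘ-mkℚᵘ zero    i d = *≡* (ℤP.*-zeroˡ (+ suc d))
·ᵘ-mkℚᵘ (suc n) i d = ℚᵘP.≃-trans (ℚᵘP.+-congʳ (mkℚᵘ i d) (·ᵘ-mkℚᵘ n i d)) (*≡* same-denominator)
  where
  add-fractions : ∀ a m D → (a ℤ.* D ℤ.+ (m ℤ.* a) ℤ.* D) ℤ.* D ≡ ((+ 1 ℤ.+ m) ℤ.* a) ℤ.* (D ℤ.* D)
  add-fractions = solve-∀
  same-denominator : (i ℤ.* + suc d ℤ.+ (+ n ℤ.* i) ℤ.* + suc d) ℤ.* + suc d
                   ≡ (+ suc n ℤ.* i) ℤ.* + (suc d ℕ.* suc d)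
  same-denominator = trans (add-fractions i (+ n) (+ suc d))
                           (cong (+ suc n ℤ.* i ℤ.*_) (sym (ℤP.pos-* (suc d) (suc d))))

-- The cross-multiplied form of (n+1)·j/(j+1) ≤ n·1/1.
cross-multiplied : ∀ {j n} → j ≤ n → suc n ℕ.* j ℕ.* 1 ≤ n ℕ.* 1 ℕ.* suc j
cross-multiplied {j} {n} j≤n = begin
  suc n ℕ.* j ℕ.* 1   ≡⟨ ℕP.*-identityʳ (suc n ℕ.* j) ⟩
  j ℕ.+ n ℕ.* j       ≤⟨ ℕP.+-monoˡ-≤ (n ℕ.* j) j≤n ⟩
  n ℕ.+ n ℕ.* j       ≡⟨ ℕP.*-suc n j ⟨
  n ℕ.* suc j         ≡⟨ cong (ℕ._* suc j) (ℕP.*-identityʳ n) ⟨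
  n ℕ.* 1 ℕ.* suc j   ∎
  where open ℕP.≤-Reasoning

thr-bound : ∀ {j n} → j ≤ n → suc n · thr j ℚ.≤ n · 1ℚ
thr-bound {j} {n} j≤n = ℚP.toℚᵘ-cancel-≤ (begin
  toℚᵘ (suc n · thr j)           ≃⟨ toℚᵘ-homo-· (suc n) (thr j) ⟩
  suc n ·ᵘ toℚᵘ (thr j)          ≃⟨ ·ᵘ-congʳ (suc n) (ℚP.toℚᵘ-fromℚᵘ (mkℚᵘ (+ j) j)) ⟩
  suc n ·ᵘ mkℚᵘ (+ j) j          ≃⟨ ·ᵘ-mkℚᵘ (suc n) (+ j) j ⟩
  mkℚᵘ (+ suc n ℤ.* + j) j       ≤⟨ *≤* (subst₂ ℤ._≤_ (pos-*³ (suc n) j 1) (pos-*³ n 1 (suc j))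
                                           (ℤ.+≤+ (cross-multiplied j≤n))) ⟩
  mkℚᵘ (+ n ℤ.* + 1) 0           ≃⟨ ·ᵘ-mkℚᵘ n (+ 1) 0 ⟨
  n ·ᵘ toℚᵘ 1ℚ                   ≃⟨ toℚᵘ-homo-· n 1ℚ ⟨
  toℚᵘ (n · 1ℚ)                  ∎)
  where
  open ℚᵘP.≤-Reasoning
  pos-*³ : ∀ a b c → + (a ℕ.* b ℕ.* c) ≡ (+ a ℤ.* + b) ℤ.* + c
  pos-*³ a b c = trans (ℤP.pos-* (a ℕ.* b) c) (cong (ℤ._* + c) (ℤP.pos-* a b))

sum-bound : ∀ {a c} (B : Bin) → All (λ x → c ℚ.< a + x) B →
            length B · c ℚ.≤ length B · a + level B
sum-bound         []      []           = ℚP.≤-reflexive (sym (ℚP.+-identityʳ 0ℚ))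
sum-bound {a} {c} (x ∷ B) (c<a+x ∷ hs) =
  subst (c + length B · c ℚ.≤_) (interchange a x (length B · a) (level B))
        (ℚP.+-mono-≤ (ℚP.<⇒≤ c<a+x) (sum-bound B hs))

sum-bound-strict : ∀ {a c x} (B : Bin) → All (λ y → c ℚ.< a + y) (x ∷ B) →
                   length (x ∷ B) · c ℚ.< length (x ∷ B) · a + level (x ∷ B)
sum-bound-strict {a} {c} {x} B (c<a+x ∷ hs) =
  subst (c + length B · c ℚ.<_) (interchange a x (length B · a) (level B))
        (ℚP.+-mono-<-≤ c<a+x (sum-bound B hs))

-- A bin with n ≥ j ≥ 1 items, each exceeding 1 - a for some a ≤ j/(j+1), has
-- level above j/(j+1): otherwise n < n·a + level ≤ (n+1)·j/(j+1) ≤ n.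
heavy-bin : ∀ {j a} (B : Bin) → 1 ≤ j → j ≤ length B → a ℚ.≤ thr j →
            All (λ x → 1ℚ ℚ.< a + x) B → thr j ℚ.< level B
heavy-bin         []      (s≤s z≤n) ()
heavy-bin {j} {a} (x ∷ B) _         j≤n a≤t large = ℚP.≰⇒> λ level≤t →
  ℚP.<-irrefl refl (ℚP.<-≤-trans (sum-bound-strict {a} B large) (begin
    n · a + level (x ∷ B)  ≤⟨ ℚP.+-mono-≤ (·-mono-≤ n a≤t) level≤t ⟩
    n · thr j + thr j      ≡⟨ ℚP.+-comm (n · thr j) (thr j) ⟩
    suc n · thr j          ≤⟨ thr-bound j≤n ⟩
    n · 1ℚ                 ∎))
  where
  n : ℕ
  n = length (x ∷ B)
  open ℚP.≤-Reasoning

filter-length≤1 : ∀ {a p} {A : Set a} {P : A → Set p} (P? : Decidable P) (xs : List A) →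
                  AllPairs (λ x y → ¬ (P x × P y)) xs → length (filter P? xs) ≤ 1
filter-length≤1 P? []       []                 = z≤n
filter-length≤1 P? (x ∷ xs) (not-both ∷ rest) with P? x
... | yes px rewrite ListP.filter-none P? (All.map (λ ¬both py → ¬both (px , py)) not-both) = s≤s z≤n
... | no _   = filter-length≤1 P? xs rest

Blocks : ℕ → Bin → ℚ → Set
Blocks k A x = k ≤ card A ⊎ 1ℚ ℚ.< level A + x

FFInvariant : ℕ → Packing → Set
FFInvariant k = AllPairs (λ A B → All (Blocks k A) B)

level-snoc : ∀ (b : Bin) {s} → 0ℚ ℚ.≤ s → level b ℚ.≤ level (b ++ [ s ])
level-snoc b {s} 0≤s =
  subst (level b ℚ.≤_) (sym (ListP.foldr-++ _+_ 0ℚ b [ s ]))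
        (foldr-seed-mono b (subst (0ℚ ℚ.≤_) (sym (ℚP.+-identityʳ s)) 0≤s))
  where
  foldr-seed-mono : ∀ (b : Bin) {c d} → c ℚ.≤ d → foldr _+_ c b ℚ.≤ foldr _+_ d b
  foldr-seed-mono []      c≤d = c≤d
  foldr-seed-mono (x ∷ b) c≤d = ℚP.+-monoʳ-≤ x (foldr-seed-mono b c≤d)

blocks-snoc : ∀ {k} (b : Bin) {s x} → 0ℚ ℚ.≤ s → Blocks k b x → Blocks k (b ++ [ s ]) x
blocks-snoc b 0≤s (inj₁ full) =
  inj₁ (ℕP.≤-trans full (subst (card b ≤_) (sym (ListP.length-++ b)) (ℕP.m≤m+n (card b) 1)))
blocks-snoc b 0≤s (inj₂ high) = inj₂ (ℚP.<-≤-trans high (ℚP.+-monoˡ-≤ _ (level-snoc b 0≤s)))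

skipped-blocks : ∀ {k} (b : Bin) {s} → ¬ (suc (card b) ≤ k × level b + s ℚ.≤ 1ℚ) → Blocks k b s
skipped-blocks {k} b ¬fits with suc (card b) ℕ.≤? k
... | yes room  = inj₂ (ℚP.≰⇒> (λ fits → ¬fits (room , fits)))
... | no ¬room  = inj₁ (ℕP.≤-pred (ℕP.≰⇒> ¬room))

ffInsert-all : ∀ {Q : ℚ → Set} k s (P : Packing) → All (All Q) P → Q s → All (All Q) (ffInsert k s P)
ffInsert-all k s []       []         qs = (qs ∷ []) ∷ []
ffInsert-all k s (b ∷ bs) (qb ∷ qbs) qs with (suc (card b) ℕ.≤? k) ×-dec ((level b + s) ℚ.≤? 1ℚ)
... | yes _ = AllP.++⁺ qb (qs ∷ []) ∷ qbs
... | no  _ = qb ∷ ffInsert-all k s bs qbs qs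

ffInsert-invariant : ∀ k {s} (P : Packing) → 0ℚ ℚ.≤ s → FFInvariant k P → FFInvariant k (ffInsert k s P)
ffInsert-invariant k     []       0≤s []                = [] ∷ []
ffInsert-invariant k {s} (b ∷ bs) 0≤s (b-blocks ∷ rest) with (suc (card b) ℕ.≤? k) ×-dec ((level b + s) ℚ.≤? 1ℚ)
... | yes _     = All.map (All.map (blocks-snoc b 0≤s)) b-blocks ∷ rest
... | no ¬fits  = ffInsert-all k s bs b-blocks (skipped-blocks b ¬fits) ∷ ffInsert-invariant k bs 0≤s rest

firstFit-invariant : ∀ k (L : List ℚ) (P : Packing) → ValidInput L → FFInvariant k P →
                     FFInvariant k (foldl (λ P s → ffInsert k s P) P L)
firstFit-invariant k []      P []                  inv = inv
firstFit-invariant k (s ∷ L) P ((0<s , _) ∷ valid) inv =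
  firstFit-invariant k L (ffInsert k s P) valid (ffInsert-invariant k P (ℚP.<⇒≤ 0<s) inv)

Light : ℕ → ℕ → Bin → Set
Light k j A = (j ≤ card A × card A < k) × level A ℚ.≤ thr j

-- A bin that is not full blocks only items that do not fit, so by heavy-bin
-- every later bin with at least j items has level above j/(j+1).
later-bins-heavy : ∀ {k j} (A B : Bin) → 1 ≤ j → All (Blocks k A) B →
                   card A < k → level A ℚ.≤ thr j → j ≤ card B → thr j ℚ.< level B
later-bins-heavy {k} A B 1≤j blocked not-full light j≤B =
  heavy-bin B 1≤j j≤B light (All.map too-high blocked)
  where
  too-high : ∀ {x} → Blocks k A x → 1ℚ ℚ.< level A + x
  too-high (inj₁ full) = ⊥-elim (ℕP.<⇒≱ not-full full)
  too-high (inj₂ high) = high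

at-most-one-light-bin : ∀ k j (L : List ℚ) → ValidInput L → 1 ≤ j →
                        {P : Bin → Set} (P? : Decidable P) → (∀ b → P b → Light k j b) →
                        length (filter P? (firstFit k L)) ≤ 1
at-most-one-light-bin k j L valid 1≤j {P} P? light =
  filter-length≤1 P? (firstFit k L)
    (AllPairs.map not-both-light (firstFit-invariant k L [] valid []))
  where
  not-both-light : ∀ {A B} → All (Blocks k A) B → ¬ (P A × P B)
  not-both-light {A} {B} blocked (pA , pB) with light A pA | light B pB
  ... | (_ , not-full) , light-A | (j≤B , _) , light-B =
    ℚP.<-irrefl refl (ℚP.<-≤-trans (later-bins-heavy A B 1≤j blocked not-full light-A j≤B) light-B)

mainTheorem15 : (k : ℕ) → 2 ≤ k → (L : List ℚ) → ValidInput L →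
    (j : ℕ) → 1 ≤ j → j ≤ k ∸ 1 →
    (length (filter (λ b → (card b ≟ j) ×-dec (level b ℚ.≤? thr j)) (firstFit k L)) ≤ 1)
    × (length (filter (λ b → ((j ℕ.≤? card b) ×-dec (card b ℕ.≤? k ∸ 1)) ×-dec (level b ℚ.≤? thr j)) (firstFit k L)) ≤ 1)
mainTheorem15 zero    ()
mainTheorem15 (suc k) _  L valid j 1≤j j≤k =
  at-most-one-light-bin (suc k) j L valid 1≤j _ exactly-j-light ,
  at-most-one-light-bin (suc k) j L valid 1≤j _ in-range-light
  where
  exactly-j-light : ∀ b → (card b ≡ j) × level b ℚ.≤ thr j → Light (suc k) j b
  exactly-j-light b (card≡j , low) =
    (ℕP.≤-reflexive (sym card≡j) , s≤s (subst (_≤ k) (sym card≡j) j≤k)) , low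
  in-range-light : ∀ b → (j ≤ card b × card b ≤ k) × level b ℚ.≤ thr j → Light (suc k) j b
  in-range-light b ((j≤card , card≤k) , low) = (j≤card , s≤s card≤k) , low
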